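{- The relation $\succeq$ is not transitive in general: there exists a game ladder $(N,T,f)$ and players $a,b,c\in N$ such that $a\succeq b$ and $b\succeq c$ but not $a\succeq c$.
   Context: A game ladder is a triple $(N,T,f)$ where $N=\{1,\dots,n\}$ is a non-empty finite set of players, $T=\{1,\dots,j\}$ with $j\ge 2$ is an ordered set of positions (higher index = more important position), and $f:T^N\to\mathbb{R}$ is monotonic: for all $x,z\in T^N$ with $x\le z$ componentwise, $f(x)\le f(z)$. For $p\in N$, $e^p$ denotes the $p$-th unit vector. For players $p,q$ and positions $r>s$ in $T$, write $p\succeq_{(r,s)}q$ if for every $x\in T^N$ with $x_p=x_q=s$ one has $f(x+(r-s)e^p)\ge f(x+(r-s)e^q)$. Write $p\succeq q$ if $p\succeq_{(r,s)}q$ for all $r,s\in T$ with $r>s$. -}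

module Defs where

open import Data.Nat using (ℕ)
open import Data.Fin using (Fin; _≟_; _<_; _≤_)
open import Data.Rational using (ℚ) renaming (_≤_ to _≤ℚ_)
open import Relation.Nullary using (yes; no)
open import Relation.Binary.PropositionalEquality using (_≡_)

-- Players N = Fin n, positions T = Fin j (position k+1 of the paper is
-- the element k of Fin j; order is the usual order on Fin).
-- A strategy profile x ∈ T^N is a function Fin n → Fin j.
Profile : ℕ → ℕ → Set
Profile n j = Fin n → Fin j

-- Payoff values: the paper uses ℝ; we use ℚ.
Payoff : ℕ → ℕ → Set
Payoff n j = Profile n j → ℚ

Monotonic : {n j : ℕ} → Payoff n j → Set
Monotonic {n} {j} f = (x z : Profile n j) → (∀ i → x i ≤ z i) → f x ≤ℚ f z

-- update x p r = the profile x with player p's position set to r.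
-- When x p = s, this is x + (r - s) e^p.
update : {n j : ℕ} → Profile n j → Fin n → Fin j → Profile n j
update x p r i with i ≟ p
... | yes _ = r
... | no _ = x i

DomAt : {n j : ℕ} → Payoff n j → Fin n → Fin n → Fin j → Fin j → Set
DomAt {n} {j} f p q r s =
  (x : Profile n j) → x p ≡ s → x q ≡ s → f (update x q r) ≤ℚ f (update x p r)

Dom : {n j : ℕ} → Payoff n j → Fin n → Fin n → Set
Dom {n} {j} f p q = (r s : Fin j) → s < r → DomAt f p q r s

-- The counterexample is a simple game with three players a, b, c and three
-- positions: a profile wins when some player is at the top position and another
-- one is above the bottom, except that b at the top together with a alone does
-- not win.  Raising a instead of b, or b instead of c, never turns a win into a
-- loss, so a ⪰ b ⪰ c.  But from the profile (bottom, top, bottom) raising c to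
-- the middle wins while raising a does not, so a ⋡ c.
module Submission where

open import Defs
open import Data.Nat using (ℕ; _≤_; s≤s; z≤n; _≤ᵇ_)
open import Data.Fin using (Fin; toℕ; zero; suc) renaming (_≤_ to _≤ᶠ_; _<_ to _<ᶠ_)
open import Data.Fin.Properties using (all?) renaming (_≤?_ to _≤ᶠ?_; _<?_ to _<ᶠ?_)
open import Data.Bool using (Bool; true; false; T; _∨_; _∧_; if_then_else_)
open import Data.Bool.Properties using (T?)
open import Data.Unit using (tt)
open import Data.Product using (Σ; _×_; _,_)
open import Data.Rational using (ℚ; 0ℚ; 1ℚ) renaming (_≤_ to _≤ℚ_)
open import Data.Rational.Properties using (≤-refl) renaming (_≤?_ to _≤ℚ?_)
open import Relation.Nullary using (¬_)
open import Relation.Nullary.Decidable using (_→-dec_; toWitness; toWitnessFalse)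
open import Relation.Binary.PropositionalEquality using (refl)

indicator : Bool → ℚ
indicator b = if b then 1ℚ else 0ℚ

0≤1 : 0ℚ ≤ℚ 1ℚ
0≤1 = toWitness {a? = 0ℚ ≤ℚ? 1ℚ} tt

1≰0 : ¬ 1ℚ ≤ℚ 0ℚ
1≰0 = toWitnessFalse {a? = 1ℚ ≤ℚ? 0ℚ} tt

indicator-mono : ∀ {p q} → (T p → T q) → indicator p ≤ℚ indicator q
indicator-mono {false} {false} _  = ≤-refl
indicator-mono {false} {true}  _  = 0≤1
indicator-mono {true}  {true}  _  = ≤-refl
indicator-mono {true}  {false} p⇒q with p⇒q tt
... | ()

indicator-reflects-≤ : ∀ {p q} → indicator p ≤ℚ indicator q → T p → T q
indicator-reflects-≤ {true} {true}  _   _ = tt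
indicator-reflects-≤ {true} {false} 1≤0 _ = 1≰0 1≤0

indicator-monotonic : ∀ {n j} (w : Profile n j → Bool) →
  (∀ x z → (∀ i → x i ≤ᶠ z i) → T (w x) → T (w z)) →
  Monotonic (λ x → indicator (w x))
indicator-monotonic w w-mono x z x≤z = indicator-mono (w-mono x z x≤z)

bottom middle top : Fin 3
bottom = zero
middle = suc zero
top    = suc (suc zero)

a b c : Fin 3
a = zero
b = suc zero
c = suc (suc zero)

isTop isAboveBottom : Fin 3 → Bool
isTop         x = 2 ≤ᵇ toℕ x
isAboveBottom x = 1 ≤ᵇ toℕ x

wins : Fin 3 → Fin 3 → Fin 3 → Bool
wins xa xb xc = (isTop xb ∧ isAboveBottom xc)
              ∨ (isTop xa ∧ isAboveBottom xc)
              ∨ (isTop xa ∧ isAboveBottom xb)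

wins-monotone : ∀ xa xb xc za zb zc → xa ≤ᶠ za → xb ≤ᶠ zb → xc ≤ᶠ zc →
  T (wins xa xb xc) → T (wins za zb zc)
wins-monotone = toWitness {a? = all? λ xa → all? λ xb → all? λ xc →
  all? λ za → all? λ zb → all? λ zc →
  xa ≤ᶠ? za →-dec xb ≤ᶠ? zb →-dec xc ≤ᶠ? zc →-dec
  T? (wins xa xb xc) →-dec T? (wins za zb zc)} tt

wins-raise-a-over-b : ∀ r s t → s <ᶠ r → T (wins s r t) → T (wins r s t)
wins-raise-a-over-b = toWitness {a? = all? λ r → all? λ s → all? λ t →
  s <ᶠ? r →-dec T? (wins s r t) →-dec T? (wins r s t)} tt

wins-raise-b-over-c : ∀ r s t → s <ᶠ r → T (wins t s r) → T (wins t r s)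
wins-raise-b-over-c = toWitness {a? = all? λ r → all? λ s → all? λ t →
  s <ᶠ? r →-dec T? (wins t s r) →-dec T? (wins t r s)} tt

ladder : Payoff 3 3
ladder x = indicator (wins (x a) (x b) (x c))

ladder-monotonic : Monotonic ladder
ladder-monotonic = indicator-monotonic _ λ x z x≤z →
  wins-monotone _ _ _ _ _ _ (x≤z a) (x≤z b) (x≤z c)

a⪰b : Dom ladder a b
a⪰b r s s<r x refl xb≡s rewrite xb≡s =
  indicator-mono (wins-raise-a-over-b r (x a) (x c) s<r)

b⪰c : Dom ladder b c
b⪰c r s s<r x refl xc≡s rewrite xc≡s =
  indicator-mono (wins-raise-b-over-c r (x b) (x a) s<r)

a⋡c : ¬ Dom ladder a c
a⋡c a⪰c = indicator-reflects-≤ (a⪰c middle bottom (s≤s z≤n) onlyBAtTop refl refl) tt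
  where
  onlyBAtTop : Profile 3 3
  onlyBAtTop = update (λ _ → bottom) b top

proposition3 : Σ ℕ λ n → Σ ℕ λ j → 1 ≤ n × 2 ≤ j ×
    (Σ (Payoff n j) λ f → Monotonic f ×
      (Σ (Fin n) λ a → Σ (Fin n) λ b → Σ (Fin n) λ c →
        Dom f a b × Dom f b c × ¬ Dom f a c))
proposition3 =
  3 , 3 , s≤s z≤n , s≤s (s≤s z≤n) ,
  ladder , ladder-monotonic , a , b , c , a⪰b , b⪰c , a⋡c
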